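{- Let $G$ be a triangle-free finite simple graph with $n$ vertices and $e$ edges, and let $r=r(P)$ be the size of an arbitrary greedy partition $P$ of $G$ (equivalently, $G$ has a non-augmentable matching with $n-r$ edges). Then $e\le r(n-r)$.
   Context: A good partition $P$ of $V(G)$ is a partition of $V(G)$ into disjoint sets $C_0,C_1,\dots$ (the cliques of $P$), each inducing a complete subgraph of $G$, indexed so that $|C_0|\le |C_1|\le \cdots$. The size $r(P)$ of $P$ is the number of cliques in it. A good partition is a greedy partition if for every $i\ge 1$ the subgraph of $G$ induced by $C_0\cup\dots\cup C_i$ contains no complete subgraph on $|C_i|+1$ vertices. For triangle-free $G$, a greedy partition consists of single vertices and edges, the single vertices forming an independent set, so the edges form a matching that cannot be extended. -}

module Defs where

open import Data.Nat using (ℕ; suc; _≤_; _<_)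
open import Data.Bool using (Bool; T)
open import Data.Fin using (Fin; toℕ)
open import Data.Fin.Properties using (_≟_)
open import Data.List using (List; length; filter; allFin; cartesianProduct)
open import Data.List.Relation.Unary.All using (All)
open import Data.List.Relation.Unary.AllPairs using (AllPairs)
open import Data.Product using (_×_; _,_; Σ; ∃; proj₁; proj₂)
open import Data.Empty using (⊥)
open import Relation.Nullary using (¬_)
open import Relation.Unary using (Decidable)
open import Relation.Binary.PropositionalEquality using (_≡_; _≢_)
open import Data.Nat.Properties using (_<?_)
open import Relation.Nullary.Decidable using (_×-dec_)
open import Data.Bool.Properties using (T?)

record Graph (n : ℕ) : Set where
  field
    adj   : Fin n → Fin n → Bool
    sym   : ∀ u v → adj u v ≡ adj v u
    irrefl : ∀ v → adj v v ≡ Data.Bool.false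

open Graph public

Adj : ∀ {n} → Graph n → Fin n → Fin n → Set
Adj G u v = T (adj G u v)

TriangleFree : ∀ {n} → Graph n → Set
TriangleFree G = ∀ u v w → Adj G u v → Adj G v w → Adj G u w → ⊥

edgeCount : ∀ {n} → Graph n → ℕ
edgeCount {n} G = length (filter dec (cartesianProduct (allFin n) (allFin n)))
  where
  dec : Decidable (λ (p : Fin n × Fin n) → (toℕ (proj₁ p) < toℕ (proj₂ p)) × Adj G (proj₁ p) (proj₂ p))
  dec (u , v) = (toℕ u <? toℕ v) ×-dec T? (adj G u v)

-- A partition of V(G) into r parts, given by the part index of each vertex.
-- Part i is C_i = { v | part v ≡ i }.
record Partition {n : ℕ} (G : Graph n) (r : ℕ) : Set where
  field
    part : Fin n → Fin r

open Partition public

partSize : ∀ {n r} {G : Graph n} → Partition G r → Fin r → ℕ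
partSize {n} P i = length (filter (λ v → part P v ≟ i) (allFin n))

-- A clique of G as a list of pairwise adjacent vertices (hence distinct, since adj is irreflexive);
-- its number of vertices is its length.
IsClique : ∀ {n} → Graph n → List (Fin n) → Set
IsClique G xs = AllPairs (Adj G) xs

IsGoodPartition : ∀ {n r} (G : Graph n) → Partition G r → Set
IsGoodPartition {n} {r} G P =
  (∀ (i : Fin r) → ∃ λ v → part P v ≡ i)
  × (∀ u v → part P u ≡ part P v → u ≢ v → Adj G u v)
  × (∀ (i j : Fin r) → toℕ i ≤ toℕ j → partSize P i ≤ partSize P j)

IsGreedyPartition : ∀ {n r} (G : Graph n) → Partition G r → Set
IsGreedyPartition {n} {r} G P =
  IsGoodPartition G P
  × (∀ (i : Fin r) → 1 ≤ toℕ i →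
       ¬ (Σ (List (Fin n)) λ xs →
            IsClique G xs
            × All (λ v → toℕ (part P v) ≤ toℕ i) xs
            × length xs ≡ suc (partSize P i)))

module Submission where

-- Every part has one or two vertices; call the two-vertex parts "pair
-- parts" and let m be their number.  Picking a representative in every
-- part and the other vertex in every pair part gives r + m distinct
-- vertices, so m ≤ n - r.  The theorem follows from e ≤ r · m, which we
-- prove by injecting the edges into the "slots" Fin r × (pair parts).
--
-- Orient each edge {a, b} so that a lies in the part of smaller index (or,
-- inside one part, a is the representative), and send it to the slot
-- (part a, part b) if a is a representative, to (part b, part a) otherwise.
-- Greediness shows that the higher part of an edge is a pair part, so slots
-- land in Fin r × (pair parts).  Triangle-freeness shows that a vertex has
-- at most one neighbour in each part, and that a part contains at most one
-- non-representative; hence a slot determines its edge.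

open import Defs
open import Data.Nat using (ℕ; suc; _≤_; _<_; _*_; _∸_; _+_; z≤n; s≤s)
open import Data.Nat.Properties
  using (≤-refl; ≤-trans; ≤-antisym; <⇒≤; <-cmp; +-suc; m+n∸m≡n; ∸-monoʳ-≤; *-monoʳ-≤; <-irrefl; <-asym; _<?_; module ≤-Reasoning)
open import Data.Bool using (T)
open import Data.Fin using (Fin; toℕ)
open import Data.Fin.Properties using (_≟_; toℕ-injective; any?)
open import Data.List using (List; []; _∷_; _++_; [_]; length; filter; allFin; cartesianProduct; map)
open import Data.List.Properties using (length-++-sucʳ; length-++; length-map; length-tabulate; filter-some)
open import Data.List.Relation.Unary.Any using (here; there)
open import Data.List.Relation.Unary.All using (All; []; _∷_) renaming (lookup to All-lookup)
open import Data.List.Relation.Unary.AllPairs using ([]; _∷_)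
open import Data.List.Relation.Unary.Unique.Propositional using (Unique)
import Data.List.Relation.Unary.Unique.Propositional.Properties as Unique
open import Data.List.Membership.Propositional using (_∈_; lose)
open import Data.List.Membership.Propositional.Properties
  using (∈-∃++; ∈-filter⁺; ∈-filter⁻; ∈-allFin; ∈-cartesianProduct⁺)
open import Data.Product using (_×_; _,_; Σ; ∃; proj₁; proj₂; swap)
open import Data.Sum using (_⊎_; inj₁; inj₂)
open import Data.Empty using (⊥; ⊥-elim)
open import Relation.Nullary using (¬_; Dec; yes; no; ¬?)
open import Relation.Nullary.Decidable using (_×-dec_; _⊎-dec_)
open import Relation.Unary using (Decidable)
open import Relation.Binary using (tri<; tri≈; tri>)
open import Relation.Binary.PropositionalEquality
  using (_≡_; _≢_; refl; trans; cong; cong₂; subst; subst₂) renaming (sym to ≡-sym)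

private
  variable
    A B : Set

∈-delete : ∀ {z b : A} (as bs : List A) → z ∈ as ++ b ∷ bs → z ≢ b → z ∈ as ++ bs
∈-delete []       bs (here z≡b)  z≢b = ⊥-elim (z≢b z≡b)
∈-delete []       bs (there z∈)  z≢b = z∈
∈-delete (a ∷ as) bs (here z≡a)  z≢b = here z≡a
∈-delete (a ∷ as) bs (there z∈)  z≢b = there (∈-delete as bs z∈ z≢b)

length-≤-injection : (f : A → B) {xs : List A} {ys : List B} → Unique xs →
  (∀ {x y} → x ∈ xs → y ∈ xs → f x ≡ f y → x ≡ y) →
  (∀ {x} → x ∈ xs → f x ∈ ys) → length xs ≤ length ys
length-≤-injection f {[]}     _              _   _    = z≤n
length-≤-injection f {x ∷ xs} {ys} (x∉xs ∷ uniq) inj into with ∈-∃++ (into (here refl))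
... | as , bs , ys≡ =
  subst (suc (length xs) ≤_) (≡-sym (trans (cong length ys≡) (length-++-sucʳ as (f x) bs)))
    (s≤s (length-≤-injection f uniq (λ y∈ z∈ → inj (there y∈) (there z∈)) into-rest))
  where
  into-rest : ∀ {y} → y ∈ xs → f y ∈ as ++ bs
  into-rest y∈ = ∈-delete as bs (subst (_ ∈_) ys≡ (into (there y∈)))
    (λ fy≡fx → All-lookup x∉xs y∈ (≡-sym (inj (there y∈) (here refl) fy≡fx)))

length-filter-≤-injection : {Q : A → Set} (Q? : Decidable Q) (f : A → B) {xs : List A} {ys : List B} →
  Unique xs → (∀ {x y} → Q x → Q y → f x ≡ f y → x ≡ y) → (∀ {x} → Q x → f x ∈ ys) →
  length (filter Q? xs) ≤ length ys
length-filter-≤-injection {Q = Q} Q? f {xs} uniq inj into = length-≤-injection f (Unique.filter⁺ Q? uniq)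
  (λ x∈ y∈ → inj (satisfies x∈) (satisfies y∈)) (λ x∈ → into (satisfies x∈))
  where
  satisfies : ∀ {x} → x ∈ filter Q? xs → Q x
  satisfies x∈ = proj₂ (∈-filter⁻ Q? {xs = xs} x∈)

length-filter-split : {P : A → Set} (P? : Decidable P) (xs : List A) →
  length (filter P? xs) + length (filter (λ x → ¬? (P? x)) xs) ≡ length xs
length-filter-split P? [] = refl
length-filter-split P? (x ∷ xs) with P? x
... | yes _ = cong suc (length-filter-split P? xs)
... | no  _ = trans (+-suc _ _) (cong suc (length-filter-split P? xs))

length-cartesianProduct : (xs : List A) (ys : List B) →
  length (cartesianProduct xs ys) ≡ length xs * length ys
length-cartesianProduct []       ys = refl
length-cartesianProduct (x ∷ xs) ys =
  trans (length-++ (map (x ,_) ys))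
        (cong₂ _+_ (length-map (x ,_) ys) (length-cartesianProduct xs ys))

length-allFin : ∀ k → length (allFin k) ≡ k
length-allFin k = length-tabulate (λ i → i)

module SimpleGraph {n : ℕ} (G : Graph n) where

  Adj-sym : ∀ {u v} → Adj G u v → Adj G v u
  Adj-sym {u} {v} = subst T (sym G u v)

  Adj-irrefl : ∀ {u v} → Adj G u v → u ≢ v
  Adj-irrefl {u} uv refl = subst T (irrefl G u) uv

module CliquePartition {n r : ℕ} (G : Graph n) (P : Partition G r)
  (triangleFree : TriangleFree G)
  (nonempty : ∀ i → ∃ λ v → part P v ≡ i)
  (cliques : ∀ u v → part P u ≡ part P v → u ≢ v → Adj G u v) where

  open SimpleGraph G

  p : Fin n → Fin r
  p = part P

  rep : Fin r → Fin n
  rep i = proj₁ (nonempty i)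

  rep-part : ∀ i → p (rep i) ≡ i
  rep-part i = proj₂ (nonempty i)

  -- A vertex has at most one neighbour in each part: two would span a triangle.
  one-neighbour-per-part : ∀ {w a b} → p a ≡ p b → Adj G w a → Adj G w b → a ≡ b
  one-neighbour-per-part {w} {a} {b} same wa wb with a ≟ b
  ... | yes a≡b = a≡b
  ... | no  a≢b = ⊥-elim (triangleFree w a b wa (cliques a b same a≢b) wb)

  -- A part has at most two vertices: three distinct ones would span a triangle.
  at-most-two-per-part : ∀ {a b c} → p a ≡ p b → p b ≡ p c → a ≢ b → b ≢ c → a ≡ c
  at-most-two-per-part {a} {b} {c} ab bc a≢b b≢c with a ≟ c
  ... | yes a≡c = a≡c
  ... | no  a≢c = ⊥-elim (triangleFree a b c (cliques a b ab a≢b) (cliques b c bc b≢c)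
                                             (cliques a c (trans ab bc) a≢c))

  non-reps-equal : ∀ {a b} → p a ≡ p b → a ≢ rep (p a) → b ≢ rep (p b) → a ≡ b
  non-reps-equal {a} {b} same a≢rep b≢rep =
    at-most-two-per-part (≡-sym (rep-part (p a))) (trans (rep-part (p a)) same)
      a≢rep (λ rep≡b → b≢rep (trans (≡-sym rep≡b) (cong rep same)))

  other-is-rep : ∀ {u v} → p u ≡ p v → u ≢ v → u ≢ rep (p u) → v ≡ rep (p v)
  other-is-rep {u} {v} same u≢v u≢rep =
    trans (at-most-two-per-part (≡-sym same) (≡-sym (rep-part (p u))) (λ v≡u → u≢v (≡-sym v≡u)) u≢rep)
          (cong rep same)

  IsPair : Fin r → Set
  IsPair i = ∃ λ z → p z ≡ i × z ≢ rep i

  isPair? : Decidable IsPair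
  isPair? i = any? (λ z → (p z ≟ i) ×-dec ¬? (z ≟ rep i))

  partner : Fin r → Fin n
  partner i with isPair? i
  ... | yes (z , _) = z
  ... | no  _       = rep i

  partner-part : ∀ i → p (partner i) ≡ i
  partner-part i with isPair? i
  ... | yes (_ , z-in-i , _) = z-in-i
  ... | no  _                = rep-part i

  partner-≢-rep : ∀ {i} → IsPair i → partner i ≢ rep i
  partner-≢-rep {i} pair with isPair? i
  ... | yes (_ , _ , z≢rep) = z≢rep
  ... | no  ¬pair           = ⊥-elim (¬pair pair)

  singleton-member : ∀ {i z} → ¬ IsPair i → p z ≡ i → z ≡ rep i
  singleton-member {i} {z} ¬pair z-in-i with z ≟ rep i
  ... | yes z≡rep = z≡rep
  ... | no  z≢rep = ⊥-elim (¬pair (z , z-in-i , z≢rep))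

  singleton-size : ∀ {i} → ¬ IsPair i → partSize P i ≡ 1
  singleton-size {i} ¬pair = ≤-antisym at-most-one at-least-one
    where
    members : List (Fin n)
    members = filter (λ v → p v ≟ i) (allFin n)
    at-most-one : length members ≤ 1
    at-most-one = length-filter-≤-injection (λ v → p v ≟ i) (λ v → v) {ys = [ rep i ]}
      (Unique.allFin⁺ n) (λ _ _ eq → eq) (λ v-in-i → here (singleton-member ¬pair v-in-i))
    at-least-one : 1 ≤ length members
    at-least-one = filter-some (λ v → p v ≟ i) (lose (∈-allFin (rep i)) (rep-part i))

  -- There are at most n - r pair parts: representatives and partners of
  -- pair parts are r + (number of pair parts) distinct vertices.
  PairParts : List (Fin r)
  PairParts = filter isPair? (allFin r)

  pairParts-≤ : length PairParts ≤ n ∸ r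
  pairParts-≤ = begin
    length PairParts             ≤⟨ pairParts-≤-nonReps ⟩
    length NonReps               ≡⟨ nonReps-count ⟩
    n ∸ length Reps              ≤⟨ ∸-monoʳ-≤ n r-≤-reps ⟩
    n ∸ r                        ∎
    where
    open ≤-Reasoning
    isRep : Decidable (λ z → z ≡ rep (p z))
    isRep z = z ≟ rep (p z)
    Reps NonReps : List (Fin n)
    Reps    = filter isRep (allFin n)
    NonReps = filter (λ z → ¬? (isRep z)) (allFin n)

    r-≤-reps : r ≤ length Reps
    r-≤-reps = subst (_≤ length Reps) (length-allFin r)
      (length-≤-injection rep (Unique.allFin⁺ r)
        (λ {i} {j} _ _ eq → trans (≡-sym (rep-part i)) (trans (cong p eq) (rep-part j)))
        (λ {i} _ → ∈-filter⁺ isRep (∈-allFin _) (cong rep (≡-sym (rep-part i)))))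

    pairParts-≤-nonReps : length PairParts ≤ length NonReps
    pairParts-≤-nonReps = length-filter-≤-injection isPair? partner (Unique.allFin⁺ r)
      (λ {i} {j} _ _ eq → trans (≡-sym (partner-part i)) (trans (cong p eq) (partner-part j)))
      (λ {i} pair → ∈-filter⁺ (λ z → ¬? (isRep z)) (∈-allFin _)
         (λ isrep → partner-≢-rep pair (trans isrep (cong rep (partner-part i)))))

    nonReps-count : length NonReps ≡ n ∸ length Reps
    nonReps-count = trans (≡-sym (m+n∸m≡n (length Reps) (length NonReps)))
      (cong (_∸ length Reps) (trans (length-filter-split isRep (allFin n)) (length-allFin n)))

  module Greedy
    (noLargeClique : ∀ (i : Fin r) → 1 ≤ toℕ i →
       ¬ (Σ (List (Fin n)) λ xs →
            IsClique G xs
            × All (λ v → toℕ (p v) ≤ toℕ i) xs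
            × length xs ≡ suc (partSize P i))) where

    -- An edge going up to a higher part ends in a pair part: otherwise the
    -- edge is a 2-clique below a part of size 1.
    upward-edge-ends-in-pair : ∀ {u v} → Adj G u v → toℕ (p u) < toℕ (p v) → IsPair (p v)
    upward-edge-ends-in-pair {u} {v} uv up with isPair? (p v)
    ... | yes pair  = pair
    ... | no  ¬pair = ⊥-elim (noLargeClique (p v) (≤-trans (s≤s z≤n) up)
      ((u ∷ v ∷ []) , ((uv ∷ []) ∷ [] ∷ []) , (<⇒≤ up ∷ ≤-refl ∷ [])
                    , cong suc (≡-sym (singleton-size ¬pair))))

    Designated : Fin n → Fin n → Set
    Designated a b = toℕ (p a) < toℕ (p b) ⊎ (p a ≡ p b × a ≡ rep (p a))

    designated? : ∀ a b → Dec (Designated a b)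
    designated? a b = (toℕ (p a) <? toℕ (p b)) ⊎-dec ((p a ≟ p b) ×-dec (a ≟ rep (p a)))

    OrientedEdge : Fin n × Fin n → Set
    OrientedEdge (a , b) = Adj G a b × Designated a b

    orient : Fin n × Fin n → Fin n × Fin n
    orient (u , v) with designated? u v
    ... | yes _ = (u , v)
    ... | no  _ = (v , u)

    orient-oriented : ∀ {u v} → Adj G u v → OrientedEdge (orient (u , v))
    orient-oriented {u} {v} uv with designated? u v
    ... | yes d = uv , d
    ... | no ¬d with <-cmp (toℕ (p u)) (toℕ (p v))
    ...   | tri< lt _ _  = ⊥-elim (¬d (inj₁ lt))
    ...   | tri> _ _ gt  = Adj-sym uv , inj₁ gt
    ...   | tri≈ _ eq _  = Adj-sym uv , inj₂ (≡-sym same , other-is-rep same (Adj-irrefl uv) u≢rep)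
      where
      same = toℕ-injective eq
      u≢rep : u ≢ rep (p u)
      u≢rep u≡rep = ¬d (inj₂ (same , u≡rep))

    orient-injective : ∀ {u₁ v₁ u₂ v₂} → toℕ u₁ < toℕ v₁ → toℕ u₂ < toℕ v₂ →
      orient (u₁ , v₁) ≡ orient (u₂ , v₂) → (u₁ , v₁) ≡ (u₂ , v₂)
    orient-injective {u₁} {v₁} {u₂} {v₂} l₁ l₂ eq with designated? u₁ v₁ | designated? u₂ v₂
    orient-injective l₁ l₂ eq   | yes _ | yes _ = eq
    orient-injective l₁ l₂ eq   | no  _ | no  _ = cong swap eq
    orient-injective l₁ l₂ refl | yes _ | no  _ = ⊥-elim (<-asym l₁ l₂)
    orient-injective l₁ l₂ refl | no  _ | yes _ = ⊥-elim (<-asym l₁ l₂)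

    slot : Fin n × Fin n → Fin r × Fin r
    slot (a , b) with a ≟ rep (p a)
    ... | yes _ = (p a , p b)
    ... | no  _ = (p b , p a)

    slot-pair : ∀ {a b} → OrientedEdge (a , b) → IsPair (proj₂ (slot (a , b)))
    slot-pair {a} {b} (ab , d) with a ≟ rep (p a)
    ... | no  a≢rep = a , refl , a≢rep
    ... | yes a≡rep with d
    ...   | inj₁ up           = upward-edge-ends-in-pair ab up
    ...   | inj₂ (same , _) =
      b , refl , λ b≡rep → Adj-irrefl ab (trans a≡rep (trans (cong rep same) (≡-sym b≡rep)))

    same-start : ∀ {a₁ b₁ a₂ b₂} → a₁ ≡ a₂ → p b₁ ≡ p b₂ → Adj G a₁ b₁ → Adj G a₂ b₂ →
      (a₁ , b₁) ≡ (a₂ , b₂)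
    same-start refl same a₁b₁ a₁b₂ = cong (_ ,_) (one-neighbour-per-part same a₁b₁ a₁b₂)

    -- A representative-started and a non-representative-started edge never
    -- share a slot: the first needs p a₁ ≤ p b₁, the second p b₁ < p a₁.
    mixed-slots-differ : ∀ {a₁ b₁ a₂ b₂} → Designated a₁ b₁ → Designated a₂ b₂ →
      a₂ ≢ rep (p a₂) → p a₁ ≡ p b₂ → p b₁ ≡ p a₂ → ⊥
    mixed-slots-differ d₁ (inj₂ (_ , a₂≡rep)) a₂≢rep _ _ = a₂≢rep a₂≡rep
    mixed-slots-differ {a₁} {b₁} d₁ (inj₁ up₂) _ a₁≡b₂ b₁≡a₂ = not-downward d₁
      where
      down : toℕ (p b₁) < toℕ (p a₁)
      down = subst₂ _<_ (cong toℕ (≡-sym b₁≡a₂)) (cong toℕ (≡-sym a₁≡b₂)) up₂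
      not-downward : Designated a₁ b₁ → ⊥
      not-downward (inj₁ up₁)        = <-asym up₁ down
      not-downward (inj₂ (same , _)) = <-irrefl (cong toℕ (≡-sym same)) down

    slot-injective : ∀ {a₁ b₁ a₂ b₂} → OrientedEdge (a₁ , b₁) → OrientedEdge (a₂ , b₂) →
      slot (a₁ , b₁) ≡ slot (a₂ , b₂) → (a₁ , b₁) ≡ (a₂ , b₂)
    slot-injective {a₁} {b₁} {a₂} {b₂} (ab₁ , d₁) (ab₂ , d₂) eq
      with a₁ ≟ rep (p a₁) | a₂ ≟ rep (p a₂)
    ... | yes r₁ | yes r₂ =
      same-start (trans r₁ (trans (cong (λ s → rep (proj₁ s)) eq) (≡-sym r₂))) (cong proj₂ eq) ab₁ ab₂
    ... | no n₁  | no n₂  = same-start (non-reps-equal (cong proj₂ eq) n₁ n₂) (cong proj₁ eq) ab₁ ab₂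
    ... | yes _  | no n₂  = ⊥-elim (mixed-slots-differ d₁ d₂ n₂ (cong proj₁ eq) (cong proj₂ eq))
    ... | no n₁  | yes _  =
      ⊥-elim (mixed-slots-differ d₂ d₁ n₁ (≡-sym (cong proj₁ eq)) (≡-sym (cong proj₂ eq)))

    edgeCount-≤-slots : edgeCount G ≤ length (cartesianProduct (allFin r) PairParts)
    edgeCount-≤-slots = length-filter-≤-injection _ (λ x → slot (orient x))
      (Unique.cartesianProduct⁺ (Unique.allFin⁺ n) (Unique.allFin⁺ n)) injective into
      where
      injective : ∀ {u₁ v₁ u₂ v₂} → toℕ u₁ < toℕ v₁ × Adj G u₁ v₁ → toℕ u₂ < toℕ v₂ × Adj G u₂ v₂ →
        slot (orient (u₁ , v₁)) ≡ slot (orient (u₂ , v₂)) → (u₁ , v₁) ≡ (u₂ , v₂)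
      injective (l₁ , uv₁) (l₂ , uv₂) eq =
        orient-injective l₁ l₂ (slot-injective (orient-oriented uv₁) (orient-oriented uv₂) eq)

      into : ∀ {u v} → toℕ u < toℕ v × Adj G u v →
        slot (orient (u , v)) ∈ cartesianProduct (allFin r) PairParts
      into (_ , uv) = ∈-cartesianProduct⁺ (∈-allFin _)
        (∈-filter⁺ isPair? (∈-allFin _) (slot-pair (orient-oriented uv)))

claim2 : ∀ (n r : ℕ) (G : Graph n) (P : Partition G r) →
    TriangleFree G → IsGreedyPartition G P →
    edgeCount G ≤ r * (n ∸ r)
claim2 n r G P triangleFree ((nonempty , cliques , _) , noLargeClique) = begin
  edgeCount G                                    ≤⟨ edgeCount-≤-slots ⟩
  length (cartesianProduct (allFin r) PairParts) ≡⟨ slots-count ⟩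
  r * length PairParts                           ≤⟨ *-monoʳ-≤ r pairParts-≤ ⟩
  r * (n ∸ r)                                    ∎
  where
  open ≤-Reasoning
  open CliquePartition G P triangleFree nonempty cliques
  open Greedy noLargeClique
  slots-count : length (cartesianProduct (allFin r) PairParts) ≡ r * length PairParts
  slots-count = trans (length-cartesianProduct (allFin r) PairParts) (cong (_* length PairParts) (length-allFin r))
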